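{- Let $S,T\in\{0,1,2\}^*$ and $x,G_x$ as in the context. For $\ell\in[1..|S|]$ and $r\in[1..|T|]$ let $v=x[\mathrm{left}^P_\ell..\mathrm{right}^P_r]$, $u_1=x[\mathrm{left}^P_{\ell+1}..\mathrm{right}^P_r]$ and $u_2=x[\mathrm{left}^P_\ell..\mathrm{right}^P_{r+1}]$, and let $\alpha=S[\ell]$, $\beta=T[r]$. Then $\mathrm{dist}_{G_x}(v,u_1)=i_\alpha+2$ and $\mathrm{dist}_{G_x}(v,u_2)=i_\beta+2$.
   Context: $i_0=55$, $i_1=54$, $i_2=53$. Alphabet $\{0,1\}$, $\overline{0}=1$, $\overline{1}=0$; $\overline{X}$ symbolwise, $\overleftarrow{X}=\overline{X[|X|]}\cdots\overline{X[1]}$. Gadgets: $I_L(\alpha)=(010^{3+2\alpha})^{i_\alpha}$, $P_L=(010^9)^{144}$, $\mathrm{Sync}_L=01$, $I_R(\alpha)=\overleftarrow{I_L(\alpha)}$, $P_R=\overleftarrow{P_L}$, $\mathrm{Sync}_R=\overline{010}$; $E_L(\alpha)=P_L\mathrm{Sync}_LI_L(\alpha)\mathrm{Sync}_L$, $E_R(\alpha)=\mathrm{Sync}_RI_R(\alpha)\mathrm{Sync}_RP_R$; $y=P_L\,\mathrm{Sync}_L\,01\,11\overline{11}\,\overline{10}\,\mathrm{Sync}_R\,P_R$, $x=E_L(S[1])\cdots E_L(S[|S|])\,y\,E_R(T[|T|])\cdots E_R(T[1])$. Indices: $\mathrm{left}^P_\ell=1+\sum_{j<\ell}|E_L(S[j])|$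 ($\ell\in[1..|S|+1]$), $\mathrm{right}^P_r=|x|-\sum_{j<r}|E_R(T[j])|$ ($r\in[1..|T|+1]$). $G_x$: vertices are substrings $x[i..j]$ (identified by positions); edges from $x[i..j]$ to $x[i+\ell..j]$ and to $x[i..j-\ell]$ whenever $1\le\ell\le\lfloor(j-i+1)/2\rfloor$ and $x[i..i+\ell-1]=\overleftarrow{x[j-\ell+1..j]}$; $\mathrm{dist}_{G_x}$ is the number of edges of a shortest path. -}

module Defs where

open import Data.Bool using (Bool; true; false; not)
open import Data.Nat using (ℕ; zero; suc; _+_; _*_; _∸_; _≤_; _/_)
open import Data.Fin using (Fin; zero; suc; toℕ)
open import Data.List using (List; []; _∷_; _++_; map; reverse; replicate; concat; concatMap; take; drop; length; lookup)
open import Data.Nat.ListAction using (sum)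
open import Data.Product using (_×_; _,_)
open import Relation.Binary.PropositionalEquality using (_≡_)

Str : Set
Str = List Bool

𝟎 𝟏 : Bool
𝟎 = false
𝟏 = true

bar : Str → Str
bar = map not

rc : Str → Str
rc X = reverse (bar X)

iα : Fin 3 → ℕ
iα zero = 55
iα (suc zero) = 54
iα (suc (suc zero)) = 53

block : ℕ → ℕ → Str
block k n = concat (replicate n (𝟎 ∷ 𝟏 ∷ replicate k 𝟎))

I-L : Fin 3 → Str
I-L α = block (3 + 2 * toℕ α) (iα α)

P-L : Str
P-L = block 9 144

Sync-L : Str
Sync-L = 𝟎 ∷ 𝟏 ∷ []

I-R : Fin 3 → Str
I-R α = rc (I-L α)

P-R : Str
P-R = rc P-L

Sync-R : Str
Sync-R = bar (𝟎 ∷ 𝟏 ∷ 𝟎 ∷ [])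

E-L : Fin 3 → Str
E-L α = P-L ++ Sync-L ++ I-L α ++ Sync-L

E-R : Fin 3 → Str
E-R α = Sync-R ++ I-R α ++ Sync-R ++ P-R

y : Str
y = P-L ++ Sync-L ++ (𝟎 ∷ 𝟏 ∷ []) ++ (𝟏 ∷ 𝟏 ∷ []) ++ bar (𝟏 ∷ 𝟏 ∷ [])
      ++ bar (𝟏 ∷ 𝟎 ∷ []) ++ Sync-R ++ P-R

xStr : List (Fin 3) → List (Fin 3) → Str
xStr S T = concatMap E-L S ++ y ++ concatMap E-R (reverse T)

leftP : List (Fin 3) → ℕ → ℕ
leftP S ℓ = 1 + sum (map (λ a → length (E-L a)) (take (ℓ ∸ 1) S))

rightP : List (Fin 3) → List (Fin 3) → ℕ → ℕ
rightP S T r = length (xStr S T) ∸ sum (map (λ a → length (E-R a)) (take (r ∸ 1) T))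

-- x[i..j] with 1-indexed inclusive positions
sub : Str → ℕ → ℕ → Str
sub x i j = take (suc j ∸ i) (drop (i ∸ 1) x)

-- Vertices of G_x: substrings x[i..j] identified by their positions (i , j).
Vertex : Set
Vertex = ℕ × ℕ

data Edge (x : Str) : Vertex → Vertex → Set where
  cutL : ∀ {i j ℓ} → 1 ≤ i → j ≤ length x → 1 ≤ ℓ → ℓ ≤ (suc j ∸ i) / 2 →
         sub x i (i + ℓ ∸ 1) ≡ rc (sub x (suc j ∸ ℓ) j) →
         Edge x (i , j) (i + ℓ , j)
  cutR : ∀ {i j ℓ} → 1 ≤ i → j ≤ length x → 1 ≤ ℓ → ℓ ≤ (suc j ∸ i) / 2 →
         sub x i (i + ℓ ∸ 1) ≡ rc (sub x (suc j ∸ ℓ) j) →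
         Edge x (i , j) (i , j ∸ ℓ)

data Walk (x : Str) : ℕ → Vertex → Vertex → Set where
  here : ∀ {v} → Walk x 0 v v
  step : ∀ {k u v w} → Edge x u v → Walk x k v w → Walk x (suc k) u w

Dist : Str → Vertex → Vertex → ℕ → Set
Dist x u v d = Walk x d u v × (∀ k → Walk x k u v → d ≤ k)

-- Walks in G_x are monotone: left ends never decrease and right ends never increase.
-- A walk from x[i..j] to x[i′..j] therefore consists of left cuts only, and a left cut of length
-- ℓ at i is available exactly when x[i..i+ℓ-1] is a prefix of the reverse complement of x[1..j]
-- (and ℓ is at most half the current length); symmetrically for right cuts. In
-- x = … E_L(α) Mid E_R(β) … the middle part Mid starts with P_L and ends with P_R and is long
-- enough that the length bound never binds, so dist(v, u₁) is the least number of cuts that use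
-- up E_L(α), each cut being a prefix of rc(E_R(β)) P_L; dist(v, u₂) is the same problem for
-- rc(E_R(β)) = P_L 010 I_L(β) 010 against E_L(α) P_L. These nine plus nine finite problems are
-- solved by evaluation: the greedy sequence P_L Sync, the i blocks of I_L, Sync gives i + 2 cuts,
-- and a potential that drops by at most one per cut shows that no fewer suffice.

module Submission where

open import Defs
open import Data.Bool using (Bool; not; if_then_else_)
open import Data.Bool.Properties using (not-involutive) renaming (_≟_ to _≟ᵇ_)
open import Data.Empty using (⊥-elim)
open import Data.Fin using (Fin; toℕ)
open import Data.Fin.Properties using (all?)
open import Data.List using (List; []; _∷_; _++_; [_]; map; reverse; replicate; concatMap; take; drop; length; lookup)
open import Data.List.Properties
  using ( ≡-dec; ∷-injectiveˡ; ∷-injectiveʳ; ++-assoc; ++-identityʳ; ++-monoid; length-++; length-++-≤ˡ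
        ; length-map; length-reverse; length-take; length-drop; map-++; map-∘; map-cong; map-id
        ; reverse-++; reverse-map; reverse-involutive; unfold-reverse; concatMap-++
        ; take-all; drop-all; take-take; take-drop; take-suc; take++drop≡id )
open import Data.List.Relation.Binary.Permutation.Propositional.Properties using (↭-reverse)
open import Data.Nat
open import Data.Nat.DivMod using (m*n/n≡m; /-monoˡ-≤; m/n≤m)
open import Data.Nat.ListAction using (sum)
open import Data.Nat.ListAction.Properties using (sum-++; sum-↭)
open import Data.Nat.Properties
open import Data.Nat.Tactic.RingSolver using (solve)
open import Data.Product using (_×_; _,_; proj₁; proj₂; ∃)
open import Data.Unit using (⊤; tt)
open import Function using (_∘_; id; _⇔_; mk⇔; Equivalence)
open import Function.Properties.Equivalence using () renaming (refl to ⇔-refl; sym to ⇔-sym; trans to ⇔-trans)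
open import Relation.Binary.PropositionalEquality
  using (_≡_; refl; sym; trans; cong; cong₂; subst; subst₂; module ≡-Reasoning)
open import Relation.Nullary using (Dec; yes; no; _×-dec_)
open import Relation.Nullary.Decidable using (toWitness; map′)
open import Tactic.MonoidSolver using () renaming (solve to solve-monoid)

m+n≤o⇒n≤o∸m : ∀ m {n o} → m + n ≤ o → n ≤ o ∸ m
m+n≤o⇒n≤o∸m m {n} {o} h = m+n≤o⇒m≤o∸n n (subst (_≤ o) (+-comm m n) h)

m∸[n∸o]≡m∸n+o : ∀ {m n o} → o ≤ n → n ≤ m → m ∸ (n ∸ o) ≡ m ∸ n + o
m∸[n∸o]≡m∸n+o {m} {n} {o} o≤n n≤m = begin
  m ∸ (n ∸ o)                        ≡⟨ cong (_∸ (n ∸ o)) m≡ ⟩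
  (m ∸ n + o) + (n ∸ o) ∸ (n ∸ o)    ≡⟨ m+n∸n≡m (m ∸ n + o) (n ∸ o) ⟩
  m ∸ n + o                          ∎
  where
  open ≡-Reasoning
  m≡ : m ≡ (m ∸ n + o) + (n ∸ o)
  m≡ = begin
    m                        ≡⟨ sym (m∸n+n≡m n≤m) ⟩
    m ∸ n + n                ≡⟨ cong (m ∸ n +_) (sym (m+[n∸m]≡n o≤n)) ⟩
    m ∸ n + (o + (n ∸ o))    ≡⟨ sym (+-assoc (m ∸ n) o (n ∸ o)) ⟩
    (m ∸ n + o) + (n ∸ o)    ∎

≤-half : ∀ {ℓ n} → ℓ * 2 ≤ n → ℓ ≤ n / 2
≤-half {ℓ} {n} h = subst (_≤ n / 2) (m*n/n≡m ℓ 2) (/-monoˡ-≤ 2 h)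

half-≤ : ∀ {ℓ n} → ℓ ≤ n / 2 → ℓ ≤ n
half-≤ {ℓ} {n} h = ≤-trans h (m/n≤m n 2)

module _ {A : Set} where

  take-++ˡ : ∀ {n} (xs ys : List A) → n ≤ length xs → take n (xs ++ ys) ≡ take n xs
  take-++ˡ {zero}  xs       ys _       = refl
  take-++ˡ {suc n} (x ∷ xs) ys (s≤s h) = cong (x ∷_) (take-++ˡ xs ys h)

  drop-++ˡ : ∀ {n} (xs ys : List A) → n ≤ length xs → drop n (xs ++ ys) ≡ drop n xs ++ ys
  drop-++ˡ {zero}  xs       ys _       = refl
  drop-++ˡ {suc n} (x ∷ xs) ys (s≤s h) = drop-++ˡ xs ys h

  take-length-++ : ∀ (xs ys : List A) → take (length xs) (xs ++ ys) ≡ xs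
  take-length-++ xs ys = trans (take-++ˡ xs ys ≤-refl) (take-all (length xs) xs ≤-refl)

  drop-length-++ : ∀ (xs ys : List A) → drop (length xs) (xs ++ ys) ≡ ys
  drop-length-++ xs ys = trans (drop-++ˡ xs ys ≤-refl) (cong (_++ ys) (drop-all (length xs) xs ≤-refl))

  length-take-≤ : ∀ {n} (xs : List A) → n ≤ length xs → length (take n xs) ≡ n
  length-take-≤ {n} xs h = trans (length-take n xs) (m≤n⇒m⊓n≡m h)

  take-drop-++ : ∀ {p ℓ} (xs ys : List A) → p + ℓ ≤ length xs →
                 take ℓ (drop p (xs ++ ys)) ≡ take ℓ (drop p xs)
  take-drop-++ {p} {ℓ} xs ys h = begin
    take ℓ (drop p (xs ++ ys))  ≡⟨ cong (take ℓ) (drop-++ˡ xs ys (m+n≤o⇒m≤o p h)) ⟩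
    take ℓ (drop p xs ++ ys)    ≡⟨ take-++ˡ (drop p xs) ys ℓ≤ ⟩
    take ℓ (drop p xs)          ∎
    where
    open ≡-Reasoning
    ℓ≤ : ℓ ≤ length (drop p xs)
    ℓ≤ = subst (ℓ ≤_) (sym (length-drop p xs)) (m+n≤o⇒n≤o∸m p h)

  take-lookup-drop : ∀ (xs : List A) (i : Fin (length xs)) →
                     xs ≡ take (toℕ i) xs ++ lookup xs i ∷ drop (suc (toℕ i)) xs
  take-lookup-drop (a ∷ xs) Fin.zero    = refl
  take-lookup-drop (a ∷ xs) (Fin.suc i) = cong (a ∷_) (take-lookup-drop xs i)

  sum-map-take-suc : ∀ (g : A → ℕ) xs (i : Fin (length xs)) →
    sum (map g (take (suc (toℕ i)) xs)) ≡ sum (map g (take (toℕ i) xs)) + g (lookup xs i)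
  sum-map-take-suc g xs i = begin
    sum (map g (take (suc (toℕ i)) xs))                         ≡⟨ cong (sum ∘ map g) (take-suc xs i) ⟩
    sum (map g (take (toℕ i) xs ++ lookup xs i ∷ []))            ≡⟨ cong sum (map-++ g (take (toℕ i) xs) _) ⟩
    sum (map g (take (toℕ i) xs) ++ g (lookup xs i) ∷ [])        ≡⟨ sum-++ (map g (take (toℕ i) xs)) _ ⟩
    sum (map g (take (toℕ i) xs)) + (g (lookup xs i) + 0)        ≡⟨ cong (sum (map g (take (toℕ i) xs)) +_) (+-identityʳ _) ⟩
    sum (map g (take (toℕ i) xs)) + g (lookup xs i)              ∎
    where open ≡-Reasoning

  module _ (f : A → Str) where

    length-concatMap : ∀ xs → length (concatMap f xs) ≡ sum (map (length ∘ f) xs)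
    length-concatMap []       = refl
    length-concatMap (a ∷ xs) = trans (length-++ (f a)) (cong (length (f a) +_) (length-concatMap xs))

    length-concatMap-reverse : ∀ xs → length (concatMap f (reverse xs)) ≡ sum (map (length ∘ f) xs)
    length-concatMap-reverse xs = begin
      length (concatMap f (reverse xs))     ≡⟨ length-concatMap (reverse xs) ⟩
      sum (map (length ∘ f) (reverse xs))   ≡⟨ cong sum (reverse-map (length ∘ f) xs) ⟩
      sum (reverse (map (length ∘ f) xs))   ≡⟨ sum-↭ (↭-reverse (map (length ∘ f) xs)) ⟩
      sum (map (length ∘ f) xs)             ∎
      where open ≡-Reasoning

    concatMap-reverse-split : ∀ xs a ys →
      concatMap f (reverse (xs ++ a ∷ ys)) ≡ concatMap f (reverse ys) ++ (f a ++ concatMap f (reverse xs))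
    concatMap-reverse-split xs a ys = begin
      concatMap f (reverse (xs ++ a ∷ ys))                    ≡⟨ cong (concatMap f) (reverse-++ xs (a ∷ ys)) ⟩
      concatMap f (reverse (a ∷ ys) ++ reverse xs)            ≡⟨ concatMap-++ f (reverse (a ∷ ys)) (reverse xs) ⟩
      concatMap f (reverse (a ∷ ys)) ++ H                     ≡⟨ cong (λ zs → concatMap f zs ++ H) (unfold-reverse a ys) ⟩
      concatMap f (reverse ys ++ a ∷ []) ++ H                 ≡⟨ cong (_++ H) (concatMap-++ f (reverse ys) (a ∷ [])) ⟩
      (G ++ (f a ++ [])) ++ H                                 ≡⟨ cong (λ zs → (G ++ zs) ++ H) (++-identityʳ (f a)) ⟩
      (G ++ f a) ++ H                                         ≡⟨ ++-assoc G (f a) H ⟩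
      G ++ (f a ++ H)                                         ∎
      where
      open ≡-Reasoning
      G = concatMap f (reverse ys)
      H = concatMap f (reverse xs)

  module _ (f g : A → Str) (w : Str) where

    concatMap-split : ∀ xs a ys zs b ts →
      concatMap f (xs ++ a ∷ ys) ++ (w ++ concatMap g (reverse (zs ++ b ∷ ts))) ≡
      concatMap f xs ++ (f a ++ ((concatMap f ys ++ (w ++ concatMap g (reverse ts))) ++ (g b ++ concatMap g (reverse zs))))
    concatMap-split xs a ys zs b ts = trans
      (cong₂ (λ u v → u ++ (w ++ v)) (concatMap-++ f xs (a ∷ ys)) (concatMap-reverse-split g zs b ts))
      (regroup (concatMap f xs) (f a) (concatMap f ys) w (concatMap g (reverse ts)) (g b) (concatMap g (reverse zs)))
      where
      regroup : ∀ (a b c d e f g : Str) →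
        (a ++ (b ++ c)) ++ (d ++ (e ++ (f ++ g))) ≡ a ++ (b ++ ((c ++ (d ++ e)) ++ (f ++ g)))
      regroup a b c d e f g = solve-monoid (++-monoid Bool)

  module _ (f : A → Str) {Q : Str} (f-ends : ∀ b → ∃ λ M → f b ≡ M ++ Q) where

    concatMap-ends : ∀ bs Z {M} → Z ≡ M ++ Q → ∃ λ M′ → Z ++ concatMap f bs ≡ M′ ++ Q
    concatMap-ends []       Z {M} Z≡ = M , trans (++-identityʳ Z) Z≡
    concatMap-ends (b ∷ bs) Z _ with concatMap-ends bs (Z ++ f b) Z++fb≡
      where
      Z++fb≡ : Z ++ f b ≡ (Z ++ proj₁ (f-ends b)) ++ Q
      Z++fb≡ = trans (cong (Z ++_) (proj₂ (f-ends b))) (sym (++-assoc Z (proj₁ (f-ends b)) Q))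
    ... | M′ , e = M′ , trans (sym (++-assoc Z (f b) (concatMap f bs))) e

length-rc : ∀ u → length (rc u) ≡ length u
length-rc u = trans (length-reverse (bar u)) (length-map not u)

rc-++ : ∀ u w → rc (u ++ w) ≡ rc w ++ rc u
rc-++ u w = trans (cong reverse (map-++ not u w)) (reverse-++ (bar u) (bar w))

rc-involutive : ∀ u → rc (rc u) ≡ u
rc-involutive u = begin
  reverse (bar (reverse (bar u)))  ≡⟨ cong reverse (reverse-map not (bar u)) ⟩
  reverse (reverse (bar (bar u)))  ≡⟨ reverse-involutive (bar (bar u)) ⟩
  bar (bar u)                      ≡⟨ sym (map-∘ u) ⟩
  map (not ∘ not) u                ≡⟨ map-cong not-involutive u ⟩
  map id u                         ≡⟨ map-id u ⟩
  u                                ∎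
  where open ≡-Reasoning

rc-split : ∀ k u → rc u ≡ rc (drop k u) ++ rc (take k u)
rc-split k u = trans (cong rc (sym (take++drop≡id k u))) (rc-++ (take k u) (drop k u))

module _ {n : ℕ} (u : Str) (n≤u : n ≤ length u) where

  private
    k = length u ∸ n
    v = rc (drop k u)
    w = rc (take k u)

    length-v : length v ≡ n
    length-v = trans (length-rc (drop k u)) (trans (length-drop k u) (m∸[m∸n]≡n n≤u))

  take-rc : take n (rc u) ≡ rc (drop (length u ∸ n) u)
  take-rc = begin
    take n (rc u)              ≡⟨ cong (take n) (rc-split k u) ⟩
    take n (v ++ w)            ≡⟨ cong (λ m → take m (v ++ w)) (sym length-v) ⟩
    take (length v) (v ++ w)   ≡⟨ take-length-++ v w ⟩
    v                          ∎
    where open ≡-Reasoning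

  drop-rc : drop n (rc u) ≡ rc (take (length u ∸ n) u)
  drop-rc = begin
    drop n (rc u)              ≡⟨ cong (drop n) (rc-split k u) ⟩
    drop n (v ++ w)            ≡⟨ cong (λ m → drop m (v ++ w)) (sym length-v) ⟩
    drop (length v) (v ++ w)   ≡⟨ drop-length-++ v w ⟩
    w                          ∎
    where open ≡-Reasoning

module _ {j : ℕ} (x : Str) (j≤x : j ≤ length x) where

  private
    length-prefix : length (take j x) ≡ j
    length-prefix = length-take-≤ x j≤x

  take-rc-prefix : ∀ {ℓ} → ℓ ≤ j → take ℓ (rc (take j x)) ≡ rc (take ℓ (drop (j ∸ ℓ) x))
  take-rc-prefix {ℓ} ℓ≤j = begin
    take ℓ (rc (take j x))
      ≡⟨ take-rc (take j x) (subst (ℓ ≤_) (sym length-prefix) ℓ≤j) ⟩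
    rc (drop (length (take j x) ∸ ℓ) (take j x))
      ≡⟨ cong (λ m → rc (drop (m ∸ ℓ) (take j x))) length-prefix ⟩
    rc (drop (j ∸ ℓ) (take j x))
      ≡⟨ cong (λ m → rc (drop (j ∸ ℓ) (take m x))) (sym (m∸n+n≡m ℓ≤j)) ⟩
    rc (drop (j ∸ ℓ) (take (j ∸ ℓ + ℓ) x))
      ≡⟨ cong rc (sym (take-drop ℓ (j ∸ ℓ) x)) ⟩
    rc (take ℓ (drop (j ∸ ℓ) x))
      ∎
    where open ≡-Reasoning

  drop-rc-prefix : ∀ {p} → p ≤ j → drop p (rc (take j x)) ≡ rc (take (j ∸ p) x)
  drop-rc-prefix {p} p≤j = begin
    drop p (rc (take j x))
      ≡⟨ drop-rc (take j x) (subst (p ≤_) (sym length-prefix) p≤j) ⟩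
    rc (take (length (take j x) ∸ p) (take j x))
      ≡⟨ cong (λ m → rc (take (m ∸ p) (take j x))) length-prefix ⟩
    rc (take (j ∸ p) (take j x))
      ≡⟨ cong rc (take-take (j ∸ p) j x) ⟩
    rc (take ((j ∸ p) ⊓ j) x)
      ≡⟨ cong (λ m → rc (take m x)) (m≤n⇒m⊓n≡m (m∸n≤m j p)) ⟩
    rc (take (j ∸ p) x)
      ∎
    where open ≡-Reasoning

-- Edges and walks of G_x

sub-suc : ∀ x i ℓ → sub x (suc i) (i + ℓ) ≡ take ℓ (drop i x)
sub-suc x i ℓ = cong (λ m → take m (drop i x)) (m+n∸m≡n i ℓ)

sub-suc-∸ : ∀ x {j ℓ} → ℓ ≤ j → sub x (suc j ∸ ℓ) j ≡ take ℓ (drop (j ∸ ℓ) x)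
sub-suc-∸ x {j} {ℓ} ℓ≤j = begin
  sub x (suc j ∸ ℓ) j              ≡⟨ cong₂ (sub x) (+-∸-assoc 1 ℓ≤j) (sym (m∸n+n≡m ℓ≤j)) ⟩
  sub x (suc (j ∸ ℓ)) (j ∸ ℓ + ℓ)  ≡⟨ sub-suc x (j ∸ ℓ) ℓ ⟩
  take ℓ (drop (j ∸ ℓ) x)          ∎
  where open ≡-Reasoning

mirror-condition : ∀ x {i j ℓ} → ℓ ≤ j → j ≤ length x →
  (sub x (suc i) (i + ℓ) ≡ rc (sub x (suc j ∸ ℓ) j)) ⇔ (take ℓ (drop i x) ≡ take ℓ (rc (take j x)))
mirror-condition x {i} {j} {ℓ} ℓ≤j j≤x = mk⇔
  (λ e → trans (sym (sub-suc x i ℓ)) (trans e right))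
  (λ e → trans (sub-suc x i ℓ) (trans e (sym right)))
  where
  right : rc (sub x (suc j ∸ ℓ) j) ≡ take ℓ (rc (take j x))
  right = trans (cong rc (sub-suc-∸ x ℓ≤j)) (sym (take-rc-prefix x j≤x ℓ≤j))

edge-monotone : ∀ {x u v} → Edge x u v → proj₁ u ≤ proj₁ v × proj₂ v ≤ proj₂ u
edge-monotone (cutL {i} {j} {ℓ} _ _ _ _ _) = m≤m+n i ℓ , ≤-refl
edge-monotone (cutR {i} {j} {ℓ} _ _ _ _ _) = ≤-refl , m∸n≤m j ℓ

walk-monotone : ∀ {x k u v} → Walk x k u v → proj₁ u ≤ proj₁ v × proj₂ v ≤ proj₂ u
walk-monotone here = ≤-refl , ≤-refl
walk-monotone (step e w) with edge-monotone e | walk-monotone w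
... | i≤i′ , j′≤j | i′≤i″ , j″≤j′ = ≤-trans i≤i′ i′≤i″ , ≤-trans j″≤j′ j′≤j

-- Cut sequences

-- Left cuts of G_x with a fixed right end j are Cuts x (rc x[1..j]) with positions shifted by one;
-- right cuts with a fixed left end i are Cuts (rc x[1..j]) x[i..], counted from the right end j.
data Cuts (A R : Str) : ℕ → ℕ → ℕ → Set where
  stop : ∀ {p} → Cuts A R 0 p p
  cut  : ∀ {k p q ℓ} → 1 ≤ ℓ → take ℓ (drop p A) ≡ take ℓ R → Cuts A R k (p + ℓ) q →
         Cuts A R (suc k) p q

cuts-monotone : ∀ {A R k p q} → Cuts A R k p q → p ≤ q
cuts-monotone stop = ≤-refl
cuts-monotone (cut {p = p} {ℓ = ℓ} _ _ c) = ≤-trans (m≤m+n p ℓ) (cuts-monotone c)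

cut-within-half : ∀ {i j p q ℓ} → p + ℓ ≤ q → i + (q + q) ≤ p + j → ℓ * 2 ≤ j ∸ p ∸ i
cut-within-half {i} {j} {p} {q} {ℓ} p+ℓ≤q h =
  m+n≤o⇒m≤o∸n (ℓ * 2) (m+n≤o⇒m≤o∸n (ℓ * 2 + i) (+-cancelˡ-≤ p _ _ (begin
    p + (ℓ * 2 + i + p)        ≡⟨ solve (i ∷ p ∷ ℓ ∷ []) ⟩
    i + ((p + ℓ) + (p + ℓ))    ≤⟨ +-monoʳ-≤ i (+-mono-≤ p+ℓ≤q p+ℓ≤q) ⟩
    i + (q + q)                ≤⟨ h ⟩
    p + j                      ∎)))
  where open ≤-Reasoning

module _ {x : Str} where

  walk⇒cutsˡ : ∀ {k j p q} → Walk x k (suc p , j) (suc q , j) → Cuts x (rc (take j x)) k p q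
  walk⇒cutsˡ here = stop
  walk⇒cutsˡ {j = j} {p} (step (cutL _ j≤x 1≤ℓ half mirror) w) =
    cut 1≤ℓ (Equivalence.to (mirror-condition x {i = p} (≤-trans (half-≤ half) (m∸n≤m j p)) j≤x) mirror)
        (walk⇒cutsˡ w)
  walk⇒cutsˡ {j = j} {p} (step (cutR _ _ 1≤ℓ half _) w) =
    ⊥-elim (<⇒≱ (∸-monoʳ-< 1≤ℓ (≤-trans (half-≤ half) (m∸n≤m j p))) (proj₂ (walk-monotone w)))

  cuts⇒walkˡ : ∀ {k j p q} → j ≤ length x → q + q ≤ p + j →
               Cuts x (rc (take j x)) k p q → Walk x k (suc p , j) (suc q , j)
  cuts⇒walkˡ _ _ stop = here
  cuts⇒walkˡ {j = j} {p} j≤x h (cut {ℓ = ℓ} 1≤ℓ match c) =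
    step (cutL (s≤s z≤n) j≤x 1≤ℓ (≤-half ℓ*2≤)
               (Equivalence.from (mirror-condition x {i = p} ℓ≤j j≤x) match))
         (cuts⇒walkˡ j≤x (≤-trans h (+-monoˡ-≤ j (m≤m+n p ℓ))) c)
    where
    ℓ*2≤ : ℓ * 2 ≤ j ∸ p
    ℓ*2≤ = cut-within-half {i = 0} {j} {p} (cuts-monotone c) h
    ℓ≤j : ℓ ≤ j
    ℓ≤j = ≤-trans (m≤m*n ℓ 2) (≤-trans ℓ*2≤ (m∸n≤m j p))

  walk⇔cutsˡ : ∀ {k j p q} → j ≤ length x → q + q ≤ p + j →
               Walk x k (suc p , j) (suc q , j) ⇔ Cuts x (rc (take j x)) k p q
  walk⇔cutsˡ j≤x h = mk⇔ walk⇒cutsˡ (cuts⇒walkˡ j≤x h)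

  walk⇒cutsʳ : ∀ {k i j m m′} → m ≤ j → j ≤ length x →
               Walk x k (suc i , m) (suc i , m′) → Cuts (rc (take j x)) (drop i x) k (j ∸ m) (j ∸ m′)
  walk⇒cutsʳ _ _ here = stop
  walk⇒cutsʳ {i = i} _ _ (step (cutL _ _ 1≤ℓ _ _) w) =
    ⊥-elim (<⇒≱ (m<m+n (suc i) 1≤ℓ) (proj₁ (walk-monotone w)))
  walk⇒cutsʳ {suc k} {i} {j} {m} {m′} m≤j j≤x (step (cutR {ℓ = ℓ} _ m≤x 1≤ℓ half mirror) w) =
    cut 1≤ℓ match
        (subst (λ p → Cuts (rc (take j x)) (drop i x) k p (j ∸ m′)) (m∸[n∸o]≡m∸n+o ℓ≤m m≤j)
               (walk⇒cutsʳ (≤-trans (m∸n≤m m ℓ) m≤j) j≤x w))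
    where
    ℓ≤m : ℓ ≤ m
    ℓ≤m = ≤-trans (half-≤ half) (m∸n≤m m i)
    match : take ℓ (drop (j ∸ m) (rc (take j x))) ≡ take ℓ (drop i x)
    match = begin
      take ℓ (drop (j ∸ m) (rc (take j x)))  ≡⟨ cong (take ℓ) (drop-rc-prefix x j≤x (m∸n≤m j m)) ⟩
      take ℓ (rc (take (j ∸ (j ∸ m)) x))     ≡⟨ cong (λ n → take ℓ (rc (take n x))) (m∸[m∸n]≡n m≤j) ⟩
      take ℓ (rc (take m x))                 ≡⟨ sym (Equivalence.to (mirror-condition x {i = i} ℓ≤m m≤x) mirror) ⟩
      take ℓ (drop i x)                      ∎
      where open ≡-Reasoning

  cuts⇒walkʳ : ∀ {k i j p q} → j ≤ length x → i + (q + q) ≤ p + j →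
               Cuts (rc (take j x)) (drop i x) k p q → Walk x k (suc i , j ∸ p) (suc i , j ∸ q)
  cuts⇒walkʳ _ _ stop = here
  cuts⇒walkʳ {suc k} {i} {j} {p} {q} j≤x h c₀@(cut {ℓ = ℓ} 1≤ℓ match c) =
    step (cutR (s≤s z≤n) (≤-trans (m∸n≤m j p) j≤x) 1≤ℓ (≤-half ℓ*2≤) mirror)
         (subst (λ m → Walk x k (suc i , m) (suc i , j ∸ q)) (sym (∸-+-assoc j p ℓ))
                (cuts⇒walkʳ j≤x (≤-trans h (+-monoˡ-≤ j (m≤m+n p ℓ))) c))
    where
    ℓ*2≤ : ℓ * 2 ≤ j ∸ p ∸ i
    ℓ*2≤ = cut-within-half {i} {j} {p} (cuts-monotone c) h
    ℓ≤ : ℓ ≤ j ∸ p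
    ℓ≤ = ≤-trans (m≤m*n ℓ 2) (≤-trans ℓ*2≤ (m∸n≤m (j ∸ p) i))
    p≤j : p ≤ j
    p≤j = +-cancelˡ-≤ p p j (≤-trans (+-mono-≤ p≤q p≤q) (≤-trans (m≤n+m (q + q) i) h))
      where p≤q = cuts-monotone c₀
    mirror : sub x (suc i) (i + ℓ) ≡ rc (sub x (suc (j ∸ p) ∸ ℓ) (j ∸ p))
    mirror = Equivalence.from (mirror-condition x {i = i} ℓ≤ (≤-trans (m∸n≤m j p) j≤x))
               (trans (sym match) (cong (take ℓ) (drop-rc-prefix x j≤x p≤j)))

  walk⇔cutsʳ : ∀ {k i j q} → j ≤ length x → i + (q + q) ≤ j →
               Walk x k (suc i , j) (suc i , j ∸ q) ⇔ Cuts (rc (take j x)) (drop i x) k 0 q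
  walk⇔cutsʳ {k} {i} {j} {q} j≤x h = mk⇔
    (λ w → subst₂ (Cuts (rc (take j x)) (drop i x) k) (n∸n≡0 j) (m∸[m∸n]≡n q≤j)
                  (walk⇒cutsʳ ≤-refl j≤x w))
    (cuts⇒walkʳ j≤x h)
    where
    q≤j : q ≤ j
    q≤j = ≤-trans (m≤m+n q q) (m+n≤o⇒n≤o i h)

module _ {A C R D : Str} {q : ℕ} (q≤A : q ≤ length A) (q≤R : q ≤ length R) where

  private
    same-segment : ∀ {p ℓ} → p + ℓ ≤ q → take ℓ (drop p (A ++ C)) ≡ take ℓ (drop p A)
    same-segment h = take-drop-++ A C (≤-trans h q≤A)

    same-prefix : ∀ {p ℓ} → p + ℓ ≤ q → take ℓ (R ++ D) ≡ take ℓ R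
    same-prefix {p} h = take-++ˡ R D (≤-trans (m+n≤o⇒n≤o p h) q≤R)

  cuts-++⁻ : ∀ {k p} → Cuts (A ++ C) (R ++ D) k p q → Cuts A R k p q
  cuts-++⁻ stop = stop
  cuts-++⁻ (cut 1≤ℓ match c) =
    cut 1≤ℓ (trans (sym (same-segment h)) (trans match (same-prefix h))) (cuts-++⁻ c)
    where h = cuts-monotone c

  cuts-++⁺ : ∀ {k p} → Cuts A R k p q → Cuts (A ++ C) (R ++ D) k p q
  cuts-++⁺ stop = stop
  cuts-++⁺ (cut 1≤ℓ match c) =
    cut 1≤ℓ (trans (same-segment h) (trans match (sym (same-prefix h)))) (cuts-++⁺ c)
    where h = cuts-monotone c

  cuts-++ : ∀ {k p} → Cuts (A ++ C) (R ++ D) k p q ⇔ Cuts A R k p q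
  cuts-++ = mk⇔ cuts-++⁻ cuts-++⁺

module _ {R : Str} where

  cuts-∷⁻ : ∀ {A a k p q} → Cuts (a ∷ A) R k (suc p) (suc q) → Cuts A R k p q
  cuts-∷⁻ stop = stop
  cuts-∷⁻ (cut 1≤ℓ match c) = cut 1≤ℓ match (cuts-∷⁻ c)

  cuts-∷⁺ : ∀ {A a k p q} → Cuts A R k p q → Cuts (a ∷ A) R k (suc p) (suc q)
  cuts-∷⁺ stop = stop
  cuts-∷⁺ (cut 1≤ℓ match c) = cut 1≤ℓ match (cuts-∷⁺ c)

  cuts-shift : ∀ B {A k p q} → Cuts (B ++ A) R k (length B + p) (length B + q) ⇔ Cuts A R k p q
  cuts-shift []      = ⇔-refl
  cuts-shift (b ∷ B) = ⇔-trans (mk⇔ cuts-∷⁻ cuts-∷⁺) (cuts-shift B)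

cuts-cong : ∀ {A A′ R R′ k p p′ q} → A ≡ A′ → R ≡ R′ → p ≡ p′ → Cuts A R k p q ⇔ Cuts A′ R′ k p′ q
cuts-cong refl refl refl = ⇔-refl

Shortest : (ℕ → Set) → ℕ → Set
Shortest P d = P d × (∀ k → P k → d ≤ k)

shortest-cong : ∀ {P Q : ℕ → Set} {d} → (∀ {k} → P k ⇔ Q k) → Shortest P d → Shortest Q d
shortest-cong P⇔Q (p , least) = Equivalence.to P⇔Q p , λ k q → least k (Equivalence.from P⇔Q q)

-- Potentials and certificates

lcp : Str → Str → ℕ
lcp (a ∷ as) (b ∷ bs) with a ≟ᵇ b
... | yes _ = suc (lcp as bs)
... | no  _ = 0
lcp _ _ = 0

lcp≤length : ∀ xs ys → lcp xs ys ≤ length xs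
lcp≤length []       _        = z≤n
lcp≤length (a ∷ as) []       = z≤n
lcp≤length (a ∷ as) (b ∷ bs) with a ≟ᵇ b
... | yes _ = s≤s (lcp≤length as bs)
... | no  _ = z≤n

≤-lcp : ∀ {ℓ} xs ys → ℓ ≤ length xs → take ℓ xs ≡ take ℓ ys → ℓ ≤ lcp xs ys
≤-lcp {zero}  _        _        _       _ = z≤n
≤-lcp {suc ℓ} (a ∷ as) []       _       ()
≤-lcp {suc ℓ} (a ∷ as) (b ∷ bs) (s≤s h) e with a ≟ᵇ b
... | yes _   = s≤s (≤-lcp as bs h (∷-injectiveʳ e))
... | no  a≢b = ⊥-elim (a≢b (∷-injectiveˡ e))

PotentialAt : (ℕ → ℕ) → Str → ℕ → Str → Set
PotentialAt f R p as = f (suc p) ≤ f p × f p ≤ suc (f (p + lcp as R))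

IsPotential : (ℕ → ℕ) → Str → Str → Set
IsPotential f A R = ∀ {p} → p < length A → PotentialAt f R p (drop p A)

module _ {f : ℕ → ℕ} {A R : Str} (potential : IsPotential f A R) where

  potential-antitone : ∀ {p p′} → p ≤′ p′ → p′ ≤ length A → f p′ ≤ f p
  potential-antitone ≤′-refl        _  = ≤-refl
  potential-antitone (≤′-step p≤′p′) p′<A =
    ≤-trans (proj₁ (potential p′<A)) (potential-antitone p≤′p′ (<⇒≤ p′<A))

  -- A cut at p is no longer than lcp (drop p A) R, and f is antitone, so a cut lowers f by at most one.
  potential-bound : ∀ {k p} → Cuts A R k p (length A) → f p ≤ k + f (length A)
  potential-bound stop = ≤-refl
  potential-bound {suc k} {p} (cut {ℓ = ℓ} 1≤ℓ match c) = begin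
    f p               ≤⟨ proj₂ (potential p<A) ⟩
    suc (f (p + L))   ≤⟨ s≤s (potential-antitone (≤⇒≤′ (+-monoʳ-≤ p ℓ≤L)) p+L≤A) ⟩
    suc (f (p + ℓ))   ≤⟨ s≤s (potential-bound c) ⟩
    suc (k + f (length A)) ∎
    where
    open ≤-Reasoning
    L = lcp (drop p A) R
    p+ℓ≤A : p + ℓ ≤ length A
    p+ℓ≤A = cuts-monotone c
    p<A : p < length A
    p<A = <-≤-trans (m<m+n p 1≤ℓ) p+ℓ≤A
    ℓ≤L : ℓ ≤ L
    ℓ≤L = ≤-lcp (drop p A) R (subst (ℓ ≤_) (sym (length-drop p A)) (m+n≤o⇒n≤o∸m p p+ℓ≤A)) match
    p+L≤A : p + L ≤ length A
    p+L≤A = subst (p + L ≤_) (m+[n∸m]≡n (<⇒≤ p<A))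
              (+-monoʳ-≤ p (subst (L ≤_) (length-drop p A) (lcp≤length (drop p A) R)))

-- IsPotential restated along the suffixes of A, so that deciding it takes a single pass over A.
PotentialSteps : (ℕ → ℕ) → Str → ℕ → Str → Set
PotentialSteps f R p []       = ⊤
PotentialSteps f R p (a ∷ as) = PotentialAt f R p (a ∷ as) × PotentialSteps f R (suc p) as

potentialSteps? : ∀ f R p as → Dec (PotentialSteps f R p as)
potentialSteps? f R p []       = yes tt
potentialSteps? f R p (a ∷ as) =
  (f (suc p) ≤? f p ×-dec f p ≤? suc (f (p + lcp (a ∷ as) R))) ×-dec potentialSteps? f R (suc p) as

steps⇒potential : ∀ {f R} A → PotentialSteps f R 0 A → IsPotential f A R
steps⇒potential {f} {R} A steps {p} p<A =
  subst (λ q → PotentialAt f R q (drop p A)) (+-identityʳ p) (lookup-step A steps p<A)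
  where
  lookup-step : ∀ {p} as → PotentialSteps f R p as →
                ∀ {m} → m < length as → PotentialAt f R (m + p) (drop m as)
  lookup-step (a ∷ as) (holds , _)    {zero}  _         = holds
  lookup-step {p} (a ∷ as) (_ , steps) {suc m} (s≤s m<as) =
    subst (λ q → PotentialAt f R q (drop m as)) (+-suc m p) (lookup-step as steps m<as)

Along : Str → Str → List ℕ → ℕ → ℕ → Set
Along A R []       p q = p ≡ q
Along A R (ℓ ∷ ℓs) p q = 1 ≤ ℓ × take ℓ (drop p A) ≡ take ℓ R × Along A R ℓs (p + ℓ) q

along? : ∀ A R ℓs p q → Dec (Along A R ℓs p q)
along? A R []       p q = p ≟ q
along? A R (ℓ ∷ ℓs) p q =
  1 ≤? ℓ ×-dec ≡-dec _≟ᵇ_ (take ℓ (drop p A)) (take ℓ R) ×-dec along? A R ℓs (p + ℓ) q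

along⇒cuts : ∀ {A R} ℓs {p q} → Along A R ℓs p q → Cuts A R (length ℓs) p q
along⇒cuts []       refl              = stop
along⇒cuts (ℓ ∷ ℓs) (1≤ℓ , match , a) = cut 1≤ℓ match (along⇒cuts ℓs a)

record Certificate (A R : Str) (d : ℕ) (f : ℕ → ℕ) (ℓs : List ℕ) : Set where
  constructor certificate
  field
    steps    : PotentialSteps f R 0 A
    f0≡d     : f 0 ≡ d
    fA≡0     : f (length A) ≡ 0
    along    : Along A R ℓs 0 (length A)
    ℓs≡d     : length ℓs ≡ d

certificate? : ∀ A R d f ℓs → Dec (Certificate A R d f ℓs)
certificate? A R d f ℓs = map′
  (λ (s , z , n , a , l) → certificate s z n a l)
  (λ (certificate s z n a l) → s , z , n , a , l)
  (potentialSteps? f R 0 A ×-dec f 0 ≟ d ×-dec f (length A) ≟ 0 ×-dec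
   along? A R ℓs 0 (length A) ×-dec length ℓs ≟ d)

certificate⇒shortest : ∀ {A R d f ℓs} → Certificate A R d f ℓs →
                       Shortest (λ k → Cuts A R k 0 (length A)) d
certificate⇒shortest {A} {R} {ℓs = ℓs} (certificate steps f0≡d fA≡0 along ℓs≡d) =
  subst (λ n → Cuts A R n 0 (length A)) ℓs≡d (along⇒cuts ℓs along) ,
  λ k c → subst₂ _≤_ f0≡d (trans (cong (k +_) fA≡0) (+-identityʳ k))
                  (potential-bound (steps⇒potential A steps) c)

-- The gadgets

blockLength : Fin 3 → ℕ
blockLength α = 5 + 2 * toℕ α

-- Cuts still needed from position p of a gadget P_L s I_L(α) s of length n with |s| = c: one for
-- each block 010^{3+2α} of I_L(α) not yet passed and one for the final s, but at most i_α + 2.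
cutsToGo : ℕ → ℕ → Fin 3 → ℕ → ℕ
cutsToGo n c α p =
  if p <ᵇ n then (iα α + 2) ⊓ suc ((n ∸ c ∸ p + blockLength α ∸ 1) / blockLength α) else 0

greedyCuts : ℕ → Fin 3 → List ℕ
greedyCuts c α = length P-L + c ∷ replicate (iα α) (blockLength α) ++ [ c ]

GadgetCertificate : Str → Str → ℕ → Fin 3 → Set
GadgetCertificate A R c α =
  Certificate A R (iα α + 2) (cutsToGo (length A) c α) (greedyCuts c α) × length A ≤ length R

gadgetCertificate? : ∀ A R c α → Dec (GadgetCertificate A R c α)
gadgetCertificate? A R c α =
  certificate? A R (iα α + 2) (cutsToGo (length A) c α) (greedyCuts c α) ×-dec length A ≤? length R

left-gadget : ∀ α β → GadgetCertificate (E-L α) (rc (E-R β) ++ P-L) 2 α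
left-gadget = toWitness {a? = all? λ α → all? λ β → gadgetCertificate? (E-L α) (rc (E-R β) ++ P-L) 2 α} _

-- rc (E-R β) = P_L 010 I_L(β) 010 is a gadget of the same shape as E-L β, with s = 010.
right-gadget : ∀ α β → GadgetCertificate (rc (E-R β)) (E-L α ++ P-L) 3 β
right-gadget = toWitness {a? = all? λ α → all? λ β → gadgetCertificate? (rc (E-R β)) (E-L α ++ P-L) 3 β} _

module Window (EL ER PL Pre Mid Suf : Str) {M₁ M₂ : Str}
              (Mid≡PL++ : Mid ≡ PL ++ M₁) (Mid≡++rcPL : Mid ≡ M₂ ++ rc PL) where

  x : Str
  x = Pre ++ (EL ++ (Mid ++ (ER ++ Suf)))

  -- x[suc |Pre| .. j] runs from the first symbol of EL to the last symbol of ER.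
  j : ℕ
  j = length Pre + (length EL + (length Mid + length ER))

  private
    W : Str
    W = Pre ++ (EL ++ (Mid ++ ER))

    x≡W++Suf : x ≡ W ++ Suf
    x≡W++Suf = sym (begin
      (Pre ++ (EL ++ (Mid ++ ER))) ++ Suf    ≡⟨ ++-assoc Pre _ Suf ⟩
      Pre ++ ((EL ++ (Mid ++ ER)) ++ Suf)    ≡⟨ cong (Pre ++_) (++-assoc EL _ Suf) ⟩
      Pre ++ (EL ++ ((Mid ++ ER) ++ Suf))    ≡⟨ cong (λ u → Pre ++ (EL ++ u)) (++-assoc Mid ER Suf) ⟩
      Pre ++ (EL ++ (Mid ++ (ER ++ Suf)))    ∎)
      where open ≡-Reasoning

    length-W : length W ≡ j
    length-W = begin
      length (Pre ++ (EL ++ (Mid ++ ER)))                 ≡⟨ length-++ Pre ⟩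
      length Pre + length (EL ++ (Mid ++ ER))             ≡⟨ cong (length Pre +_) (length-++ EL) ⟩
      length Pre + (length EL + length (Mid ++ ER))       ≡⟨ cong (λ n → length Pre + (length EL + n)) (length-++ Mid) ⟩
      j                                                   ∎
      where open ≡-Reasoning

    rc-Mid : rc Mid ≡ PL ++ rc M₂
    rc-Mid = begin
      rc Mid                ≡⟨ cong rc Mid≡++rcPL ⟩
      rc (M₂ ++ rc PL)      ≡⟨ rc-++ M₂ (rc PL) ⟩
      rc (rc PL) ++ rc M₂   ≡⟨ cong (_++ rc M₂) (rc-involutive PL) ⟩
      PL ++ rc M₂           ∎
      where open ≡-Reasoning

    RestR : Str
    RestR = rc M₂ ++ (rc EL ++ rc Pre)

    RestD : Str
    RestD = M₁ ++ (ER ++ Suf)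

    rc-prefix : rc (take j x) ≡ rc ER ++ (PL ++ RestR)
    rc-prefix = begin
      rc (take j x)                                  ≡⟨ cong₂ (λ n u → rc (take n u)) (sym length-W) x≡W++Suf ⟩
      rc (take (length W) (W ++ Suf))                ≡⟨ cong rc (take-length-++ W Suf) ⟩
      rc (Pre ++ (EL ++ (Mid ++ ER)))                ≡⟨ rc-++ Pre _ ⟩
      rc (EL ++ (Mid ++ ER)) ++ rc Pre               ≡⟨ cong (_++ rc Pre) (rc-++ EL _) ⟩
      (rc (Mid ++ ER) ++ rc EL) ++ rc Pre            ≡⟨ cong (λ u → (u ++ rc EL) ++ rc Pre) (rc-++ Mid ER) ⟩
      ((rc ER ++ rc Mid) ++ rc EL) ++ rc Pre         ≡⟨ ++-assoc (rc ER ++ rc Mid) (rc EL) (rc Pre) ⟩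
      (rc ER ++ rc Mid) ++ (rc EL ++ rc Pre)         ≡⟨ ++-assoc (rc ER) (rc Mid) _ ⟩
      rc ER ++ (rc Mid ++ (rc EL ++ rc Pre))         ≡⟨ cong (λ u → rc ER ++ (u ++ (rc EL ++ rc Pre))) rc-Mid ⟩
      rc ER ++ ((PL ++ rc M₂) ++ (rc EL ++ rc Pre))  ≡⟨ cong (rc ER ++_) (++-assoc PL (rc M₂) _) ⟩
      rc ER ++ (PL ++ RestR)                         ∎
      where open ≡-Reasoning

    drop-prefix : drop (length Pre) x ≡ EL ++ (PL ++ RestD)
    drop-prefix = begin
      drop (length Pre) x                ≡⟨ drop-length-++ Pre _ ⟩
      EL ++ (Mid ++ (ER ++ Suf))         ≡⟨ cong (λ u → EL ++ (u ++ (ER ++ Suf))) Mid≡PL++ ⟩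
      EL ++ ((PL ++ M₁) ++ (ER ++ Suf))  ≡⟨ cong (EL ++_) (++-assoc PL M₁ _) ⟩
      EL ++ (PL ++ RestD)                ∎
      where open ≡-Reasoning

    PL≤Mid : length PL ≤ length Mid
    PL≤Mid = subst (length PL ≤_) (cong length (sym Mid≡PL++)) (length-++-≤ˡ PL)

  length-x : length x ≡ j + length Suf
  length-x = trans (cong length x≡W++Suf) (trans (length-++ W) (cong (_+ length Suf) length-W))

  j≤x : j ≤ length x
  j≤x = subst (j ≤_) (sym length-x) (m≤m+n j (length Suf))

  left-distance : ∀ {d} → length EL ≤ length (rc ER ++ PL) →
    Shortest (λ k → Cuts EL (rc ER ++ PL) k 0 (length EL)) d →
    Dist x (suc (length Pre) , j) (suc (length Pre + length EL) , j) d
  left-distance EL≤ shortest = shortest-cong (⇔-sym walk⇔cuts) shortest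
    where
    a = length Pre
    e = length EL
    e≤ : e ≤ length Mid + length ER
    e≤ = begin
      e                           ≤⟨ EL≤ ⟩
      length (rc ER ++ PL)        ≡⟨ length-++ (rc ER) ⟩
      length (rc ER) + length PL  ≡⟨ cong (_+ length PL) (length-rc ER) ⟩
      length ER + length PL       ≤⟨ +-monoʳ-≤ (length ER) PL≤Mid ⟩
      length ER + length Mid      ≡⟨ +-comm (length ER) (length Mid) ⟩
      length Mid + length ER      ∎
      where open ≤-Reasoning
    fits : (a + e) + (a + e) ≤ a + j
    fits = begin
      (a + e) + (a + e)   ≡⟨ +-assoc a e (a + e) ⟩
      a + (e + (a + e))   ≡⟨ cong (a +_) (sym (+-assoc e a e)) ⟩
      a + ((e + a) + e)   ≡⟨ cong (λ n → a + (n + e)) (+-comm e a) ⟩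
      a + ((a + e) + e)   ≡⟨ cong (a +_) (+-assoc a e e) ⟩
      a + (a + (e + e))   ≤⟨ +-monoʳ-≤ a (+-monoʳ-≤ a (+-monoʳ-≤ e e≤)) ⟩
      a + j               ∎
      where open ≤-Reasoning
    walk⇔cuts : ∀ {k} → Walk x k (suc a , j) (suc (a + e) , j) ⇔ Cuts EL (rc ER ++ PL) k 0 e
    walk⇔cuts =
      ⇔-trans (walk⇔cutsˡ j≤x fits)
      (⇔-trans (cuts-cong refl (trans rc-prefix (sym (++-assoc (rc ER) PL RestR))) (sym (+-identityʳ a)))
      (⇔-trans (cuts-shift Pre)
               (cuts-++ ≤-refl EL≤)))

  right-distance : ∀ {d} → length (rc ER) ≤ length (EL ++ PL) →
    Shortest (λ k → Cuts (rc ER) (EL ++ PL) k 0 (length (rc ER))) d →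
    Dist x (suc (length Pre) , j) (suc (length Pre) , j ∸ length ER) d
  right-distance {d} ER≤ shortest =
    shortest-cong (⇔-sym walk⇔cuts)
      (subst (λ q → Shortest (λ k → Cuts (rc ER) (EL ++ PL) k 0 q) d) (length-rc ER) shortest)
    where
    a = length Pre
    r = length ER
    r≤rc : r ≤ length (rc ER)
    r≤rc = ≤-reflexive (sym (length-rc ER))
    r≤e+m : r ≤ length EL + length Mid
    r≤e+m = begin
      r                        ≤⟨ ≤-trans r≤rc ER≤ ⟩
      length (EL ++ PL)        ≡⟨ length-++ EL ⟩
      length EL + length PL    ≤⟨ +-monoʳ-≤ (length EL) PL≤Mid ⟩
      length EL + length Mid   ∎
      where open ≤-Reasoning
    fits : a + (r + r) ≤ j
    fits = +-monoʳ-≤ a (begin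
      r + r                             ≤⟨ +-monoˡ-≤ r r≤e+m ⟩
      (length EL + length Mid) + r      ≡⟨ +-assoc (length EL) (length Mid) r ⟩
      length EL + (length Mid + r)      ∎)
      where open ≤-Reasoning
    walk⇔cuts : ∀ {k} → Walk x k (suc a , j) (suc a , j ∸ r) ⇔ Cuts (rc ER) (EL ++ PL) k 0 r
    walk⇔cuts =
      ⇔-trans (walk⇔cutsʳ j≤x fits)
      (⇔-trans (cuts-cong rc-prefix (trans drop-prefix (sym (++-assoc EL PL RestD))) refl)
               (cuts-++ r≤rc (≤-trans r≤rc ER≤)))

middle : List (Fin 3) → List (Fin 3) → Str
middle SB TB = concatMap E-L SB ++ (y ++ concatMap E-R (reverse TB))

-- y = P_L ++ y-inner ++ P_R
y-inner : Str
y-inner = Sync-L ++ ((𝟎 ∷ 𝟏 ∷ []) ++ ((𝟏 ∷ 𝟏 ∷ []) ++ (bar (𝟏 ∷ 𝟏 ∷ []) ++ (bar (𝟏 ∷ 𝟎 ∷ []) ++ Sync-R))))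

middle-starts-with-P-L : ∀ SB TB → ∃ λ M → middle SB TB ≡ P-L ++ M
middle-starts-with-P-L []       TB = _ , ++-assoc P-L (y-inner ++ P-R) (concatMap E-R (reverse TB))
middle-starts-with-P-L (α ∷ SB) TB = _ , trans
  (cong (_++ Z) (++-assoc P-L (Sync-L ++ (I-L α ++ Sync-L)) (concatMap E-L SB)))
  (++-assoc P-L ((Sync-L ++ (I-L α ++ Sync-L)) ++ concatMap E-L SB) Z)
  where Z = y ++ concatMap E-R (reverse TB)

E-R-ends : ∀ β → ∃ λ M → E-R β ≡ M ++ P-R
E-R-ends β = Sync-R ++ (I-R β ++ Sync-R) , cong (Sync-R ++_) (sym (++-assoc (I-R β) Sync-R P-R))

middle-ends-with-P-R : ∀ SB TB → ∃ λ M → middle SB TB ≡ M ++ P-R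
middle-ends-with-P-R SB TB =
  let M , e = concatMap-ends E-R E-R-ends (reverse TB) (F ++ y) F++y≡
  in  M , trans (sym (++-assoc F y (concatMap E-R (reverse TB)))) e
  where
  F = concatMap E-L SB
  F++y≡ : F ++ y ≡ (F ++ (P-L ++ y-inner)) ++ P-R
  F++y≡ = trans (cong (F ++_) (sym (++-assoc P-L y-inner P-R))) (sym (++-assoc F (P-L ++ y-inner) P-R))

leftP-suc : ∀ S (ℓ : Fin (length S)) → leftP S (suc (toℕ ℓ)) ≡ suc (length (concatMap E-L (take (toℕ ℓ) S)))
leftP-suc S ℓ = cong suc (sym (length-concatMap E-L (take (toℕ ℓ) S)))

leftP-suc-suc : ∀ S (ℓ : Fin (length S)) →
  leftP S (suc (suc (toℕ ℓ))) ≡ leftP S (suc (toℕ ℓ)) + length (E-L (lookup S ℓ))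
leftP-suc-suc S ℓ = cong suc (sum-map-take-suc (length ∘ E-L) S ℓ)

rightP-suc : ∀ S T (r : Fin (length T)) →
  rightP S T (suc (toℕ r)) ≡ length (xStr S T) ∸ length (concatMap E-R (reverse (take (toℕ r) T)))
rightP-suc S T r = cong (length (xStr S T) ∸_) (sym (length-concatMap-reverse E-R (take (toℕ r) T)))

rightP-suc-suc : ∀ S T (r : Fin (length T)) →
  rightP S T (suc (suc (toℕ r))) ≡ rightP S T (suc (toℕ r)) ∸ length (E-R (lookup T r))
rightP-suc-suc S T r =
  trans (cong (length (xStr S T) ∸_) (sum-map-take-suc (length ∘ E-R) T r))
        (sym (∸-+-assoc (length (xStr S T)) (sum (map (length ∘ E-R) (take (toℕ r) T)))
                        (length (E-R (lookup T r)))))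

dist-cong : ∀ {x x′ u u′ v v′ d} → x ≡ x′ → u ≡ u′ → v ≡ v′ → Dist x u v d → Dist x′ u′ v′ d
dist-cong refl refl refl dist = dist

module Boundary (S T : List (Fin 3)) (ℓ : Fin (length S)) (r : Fin (length T)) where

  α β : Fin 3
  α = lookup S ℓ
  β = lookup T r

  private
    SA = take (toℕ ℓ) S
    SB = drop (suc (toℕ ℓ)) S
    TA = take (toℕ r) T
    TB = drop (suc (toℕ r)) T
    Pre = concatMap E-L SA
    Suf = concatMap E-R (reverse TA)

  open Window (E-L α) (E-R β) P-L Pre (middle SB TB) Suf
              (proj₂ (middle-starts-with-P-L SB TB)) (proj₂ (middle-ends-with-P-R SB TB)) public

  x≡xStr : x ≡ xStr S T
  -- The implicit arguments of cong₂ are given so that unification does not unfold xStr.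
  x≡xStr = sym (begin
    xStr S T                            ≡⟨ cong₂ xStr {S} {SA ++ α ∷ SB} {T} {TA ++ β ∷ TB}
                                                 (take-lookup-drop S ℓ) (take-lookup-drop T r) ⟩
    xStr (SA ++ α ∷ SB) (TA ++ β ∷ TB)  ≡⟨ concatMap-split E-L E-R y SA α SB TA β TB ⟩
    x                                   ∎)
    where open ≡-Reasoning

  i≡leftP : suc (length Pre) ≡ leftP S (suc (toℕ ℓ))
  i≡leftP = sym (leftP-suc S ℓ)

  i′≡leftP : suc (length Pre + length (E-L α)) ≡ leftP S (suc (suc (toℕ ℓ)))
  i′≡leftP = sym (trans (leftP-suc-suc S ℓ) (cong (_+ length (E-L α)) (leftP-suc S ℓ)))

  j≡rightP : j ≡ rightP S T (suc (toℕ r))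
  j≡rightP = sym (begin
    rightP S T (suc (toℕ r))          ≡⟨ rightP-suc S T r ⟩
    length (xStr S T) ∸ length Suf    ≡⟨ cong (_∸ length Suf) (trans (cong length (sym x≡xStr)) length-x) ⟩
    j + length Suf ∸ length Suf       ≡⟨ m+n∸n≡m j (length Suf) ⟩
    j                                 ∎)
    where open ≡-Reasoning

  j′≡rightP : j ∸ length (E-R β) ≡ rightP S T (suc (suc (toℕ r)))
  j′≡rightP = sym (trans (rightP-suc-suc S T r) (cong (_∸ length (E-R β)) (sym j≡rightP)))

  distance-to-u₁ : Dist x (suc (length Pre) , j) (suc (length Pre + length (E-L α)) , j) (iα α + 2)
  distance-to-u₁ = left-distance (proj₂ (left-gadget α β)) (certificate⇒shortest (proj₁ (left-gadget α β)))

  distance-to-u₂ : Dist x (suc (length Pre) , j) (suc (length Pre) , j ∸ length (E-R β)) (iα β + 2)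
  distance-to-u₂ = right-distance (proj₂ (right-gadget α β)) (certificate⇒shortest (proj₁ (right-gadget α β)))

lemma21 : (S T : List (Fin 3)) (ℓ : Fin (length S)) (r : Fin (length T)) →
    let x = xStr S T
        l = suc (toℕ ℓ)
        rr = suc (toℕ r)
        v = (leftP S l , rightP S T rr)
        u₁ = (leftP S (suc l) , rightP S T rr)
        u₂ = (leftP S l , rightP S T (suc rr))
    in Dist x v u₁ (iα (lookup S ℓ) + 2) × Dist x v u₂ (iα (lookup T r) + 2)
lemma21 S T ℓ r =
  dist-cong x≡xStr (cong₂ _,_ i≡leftP j≡rightP) (cong₂ _,_ i′≡leftP j≡rightP) distance-to-u₁ ,
  dist-cong x≡xStr (cong₂ _,_ i≡leftP j≡rightP) (cong₂ _,_ i≡leftP j′≡rightP) distance-to-u₂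
  where open Boundary S T ℓ r
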